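{- Let $\phi$ be a monotone 3-CNF formula and let $P_\phi$ be the permutation graph with the $m$ vertex pairs $\{u_t^1,u_t^2\}_{t=1}^m$ constructed from $\phi$ as in the context. If $P_\phi$ is an acyclic permutation graph with respect to $\{u_t^1,u_t^2\}_{t=1}^m$, then $\phi$ is NAE-satisfiable.
   Context: A monotone 3-CNF formula has no negated variables; each clause has three distinct variables. $\phi$ is NAE-satisfiable if some truth assignment makes every clause contain at least one true and at least one false variable. Permutation representations: $L_1,L_2$ are horizontal parallel lines; a permutation representation $R$ is a set of segments ("lines") from $L_1$ to $L_2$ with distinct endpoints; its graph has the lines as vertices, adjacent iff crossing; $\theta_R(x)$ is the angle of line $x$ with $L_2$, and $\Phi_R$ orients each edge $xy$ from $x$ to $y$ iff $\theta_R(x)<\theta_R(y)$. If the $2m$ vertices of a permutation graph are grouped into pairs $\{w_t^1,w_t^2\}$, let $F_R$ be the directed graph on $\{w_1,\ldots,w_m\}$ obtained by merging each pair into $w_t$, with an arc $w_s\to w_t$ ($s\neq t$) whenever $\Phi_R$ has an arc from a member of pair $s$ to a member of pair $t$. $R$ is acyclic w.r.t. the pairs if $F_R$ has no directed cycle; the graph is acyclic w.r.t. the pairs if it has some permutation representation $R$ that is. Construction of $P_\phi$: let $\phi=\alpha_1\wedge\cdots\wedge\alpha_k$ over $x_1,\ldots,x_n$, $\alpha_i=(x_{r_{i,1}}\vee x_{r_{i,2}}\vee x_{r_{i,3}})$, $r_{i,1}<r_{i,2}<r_{i,3}$. Build a permutation representation $R_P$: for each occurrence $(i,j)$ a pair of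 crossing lines $\ell^1_{i,j},\ell^2_{i,j}$ with $\theta(\ell^1_{i,j})>\theta(\ell^2_{i,j})$; write $(a_i,c_i)=(\ell^1_{i,1},\ell^2_{i,1})$, $(e_i,b_i)=(\ell^1_{i,2},\ell^2_{i,2})$, $(d_i,f_i)=(\ell^1_{i,3},\ell^2_{i,3})$. Lines of different occurrences do not cross; all occurrences of $x_p$ lie to the left of all occurrences of $x_{p'}$ when $p<p'$, occurrences of the same variable in an arbitrary order. For any two consecutive occurrences $(i,j)$ (left) and $(i',j')$ (right) of the same variable, add two parallel lines $u^{i',j'}_{i,j},v^{i',j'}_{i,j}$, each crossing exactly $\ell^1_{i,j}$ and $\ell^1_{i',j'}$, with angle smaller than both of these. $P_\phi$ is the resulting permutation graph, with $2m$ vertices, $m=6k-n$. Its pairs are $\{a_i,b_i\},\{c_i,d_i\},\{e_i,f_i\}$ for $i=1,\ldots,k$, and $\{u^{i',j'}_{i,j},v^{i',j'}_{i,j}\}$ for each added pair of parallel lines. -}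

module Defs where

open import Data.Nat using (ℕ; _+_; _*_; _<_)
open import Data.Fin using (Fin; toℕ; zero; suc)
import Data.Fin as F
open import Data.Bool using (Bool; true; false)
open import Data.Product using (Σ; ∃; _×_; _,_; proj₁; proj₂)
open import Data.Sum using (_⊎_)
open import Relation.Binary.PropositionalEquality using (_≡_; _≢_)
open import Relation.Nullary using (¬_)
open import Function.Definitions using (Injective; Bijective)
open import Relation.Binary.Construct.Closure.Transitive using (TransClosure)

-- A monotone clause (x_{r1} ∨ x_{r2} ∨ x_{r3}) with r1 < r2 < r3.
record Clause (n : ℕ) : Set where
  constructor clause
  field
    r₁ r₂ r₃ : Fin n
    r₁<r₂    : r₁ F.< r₂
    r₂<r₃    : r₂ F.< r₃

-- j-th variable (j ∈ {0,1,2}, i.e. positions 1,2,3 of the paper) of a clause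
varOf : ∀ {n} → Clause n → Fin 3 → Fin n
varOf c zero             = Clause.r₁ c
varOf c (suc zero)       = Clause.r₂ c
varOf c (suc (suc zero)) = Clause.r₃ c

Formula : ℕ → ℕ → Set
Formula n k = Fin k → Clause n

NAESat : ∀ {n k} → Formula n k → Set
NAESat {n} {k} φ =
  Σ (Fin n → Bool) λ β → ∀ (i : Fin k) →
    (∃ λ j → β (varOf (φ i) j) ≡ true) × (∃ λ j → β (varOf (φ i) j) ≡ false)

-- Lines are indexed by V; line x joins the point (top x) on L₁ (upper
-- line) to the point (bot x) on L₂ (lower line).  Only the left-to-right order of endpoints matters, so
-- positions are natural numbers.
record PermRep (V : Set) : Set where
  field
    top bot : V → ℕ
    top-inj : Injective _≡_ _≡_ top
    bot-inj : Injective _≡_ _≡_ bot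

module _ {V : Set} (R : PermRep V) where
  open PermRep R

  Cross : V → V → Set
  Cross x y = (top x < top y × bot y < bot x) ⊎ (top y < top x × bot x < bot y)

  -- θ_R(x) < θ_R(y), where θ_R(x) ∈ (0,π) is the angle of line x with L₂
  -- (measured counterclockwise from the positive direction of L₂).  With
  -- L₁ at height 1 and L₂ at height 0, line x has direction
  -- (top x − bot x , 1), so θ_R is strictly decreasing in top x − bot x:
  -- θ_R(x) < θ_R(y)  iff  top y − bot y < top x − bot x.
  θ< : V → V → Set
  θ< x y = top y + bot x < top x + bot y

  Φ : V → V → Set
  Φ x y = Cross x y × θ< x y

  Represents : (V → V → Set) → Set
  Represents Adj = ∀ x y → (Adj x y → Cross x y) × (Cross x y → Adj x y)

  module _ {P : Set} (pair : V → P) where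
    FArc : P → P → Set
    FArc s t = s ≢ t × Σ V λ x → Σ V λ y → pair x ≡ s × pair y ≡ t × Φ x y

Acyclic : {P : Set} → (P → P → Set) → Set
Acyclic {P} E = ∀ (s : P) → ¬ TransClosure E s s

-- The graph (V, Adj) is acyclic w.r.t. the pairs given by  pair : V → P
-- (the fibres of  pair  are the pairs)
AcyclicWrt : {V P : Set} → (V → V → Set) → (V → P) → Set
AcyclicWrt {V} Adj pair =
  Σ (PermRep V) λ R → Represents R Adj × Acyclic (FArc R pair)

Occ : ℕ → Set
Occ k = Fin k × Fin 3

occVar : ∀ {n k} → Formula n k → Occ k → Fin n
occVar φ (i , j) = varOf (φ i) j

-- The left-to-right order of the 3k occurrences in R_P: position p holds
-- occurrence σ p.  All occurrences of x_p lie left of those of x_{p'}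
-- when p < p'; the order among occurrences of one variable is arbitrary.
record Layout {n k : ℕ} (φ : Formula n k) : Set where
  field
    σ      : Fin (3 * k) → Occ k
    σ-bij  : Bijective _≡_ _≡_ σ
    sorted : ∀ p q → occVar φ (σ p) F.< occVar φ (σ q) → p F.< q

module _ {n k : ℕ} (φ : Formula n k) (L : Layout φ) where
  open Layout L

  Link : Set
  Link = Σ (Fin (3 * k)) λ p → Σ (Fin (3 * k)) λ q →
           toℕ q ≡ ℕ.suc (toℕ p) × occVar φ (σ p) ≡ occVar φ (σ q)

  leftOcc rightOcc : Link → Occ k
  leftOcc  (p , q , _) = σ p
  rightOcc (p , q , _) = σ q

  data PV : Set where
    ℓ¹ ℓ² : Occ k → PV
    u v   : Link → PV

  data PArc : PV → PV → Set where
    ℓℓ  : ∀ o → PArc (ℓ¹ o) (ℓ² o)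
    uL  : ∀ λ' → PArc (u λ') (ℓ¹ (leftOcc λ'))
    uR  : ∀ λ' → PArc (u λ') (ℓ¹ (rightOcc λ'))
    vL  : ∀ λ' → PArc (v λ') (ℓ¹ (leftOcc λ'))
    vR  : ∀ λ' → PArc (v λ') (ℓ¹ (rightOcc λ'))

  PAdj : PV → PV → Set
  PAdj x y = PArc x y ⊎ PArc y x

  data PPair : Set where
    ab cd ef : Fin k → PPair
    uv       : Link → PPair

  -- a_i = ℓ¹_{i,1}, c_i = ℓ²_{i,1}, e_i = ℓ¹_{i,2}, b_i = ℓ²_{i,2},
  -- d_i = ℓ¹_{i,3}, f_i = ℓ²_{i,3}   (paper's j = 1,2,3 is Fin 3 = 0,1,2)
  pairOf : PV → PPair
  pairOf (ℓ¹ (i , zero))             = ab i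
  pairOf (ℓ² (i , zero))             = cd i
  pairOf (ℓ¹ (i , suc zero))         = ef i
  pairOf (ℓ² (i , suc zero))         = ab i
  pairOf (ℓ¹ (i , suc (suc zero)))   = cd i
  pairOf (ℓ² (i , suc (suc zero)))   = ef i
  pairOf (u λ')                      = uv λ'
  pairOf (v λ')                      = uv λ'

-- Call an occurrence o reversed in R when ℓ²_o starts left of ℓ¹_o on L₁,
-- i.e. when Φ_R orients the edge ℓ¹_o → ℓ²_o.  The assignment sets x true
-- iff some occurrence of x is reversed.
--
--  * Crossing in a permutation representation is comparability for the
--    strict order "x crosses y from the left", and a short order-theoretic
--    argument (transfer) shows that the line u of a link forces the two
--    occurrences it joins to be reversed together.
--  * Occurrences of one variable form a contiguous block of the layout,
--    consecutive ones are joined by links, so reversal depends only on the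
--    variable; hence "x is true iff an occurrence of x is reversed" is a
--    faithful description of every occurrence.
--  * If the three occurrences of a clause are all reversed (all not
--    reversed), the pairs ab, cd, ef form a directed 3-cycle in F_R, so
--    every clause gets a true and a false variable.
module Submission where

open import Defs

open import Data.Nat using (ℕ; zero; suc; _+_; _*_; _∸_; _≤_; _<_; _<?_; s≤s)
open import Data.Nat.Properties
  using (<-trans; ≤-<-trans; <⇒≱; +-mono-<; m≤n+m; n≤1+n; +-suc; m∸n+n≡m; ≤-total)
open import Data.Fin using (Fin; toℕ; fromℕ<)
import Data.Fin as F
import Data.Fin.Properties as FP
open import Data.Bool using (Bool; true; false)
open import Data.Bool.Properties using (¬-not)
import Data.Bool.Properties as BP
open import Data.Product using (∃; _×_; _,_; proj₁; proj₂)
open import Data.Sum using (_⊎_; inj₁; inj₂; swap)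
open import Data.Empty using (⊥-elim)
open import Level using (Level)
open import Relation.Binary.Core using (Rel)
open import Relation.Binary.Definitions using (Transitive; Decidable; tri<; tri≈; tri>)
open import Relation.Binary.PropositionalEquality
  using (_≡_; _≢_; refl; sym; trans; cong; subst; ≢-sym)
open import Relation.Binary.Construct.Closure.Transitive using ([_]; _∷_)
open import Relation.Nullary using (¬_; Dec; yes; no)
open import Relation.Nullary.Decidable using (isYes; _×-dec_)
open import Function.Bundles using (_⇔_; mk⇔; Equivalence)
open import Function.Construct.Identity using (⇔-id)
open import Function.Construct.Composition using (_⇔-∘_)

open Equivalence using (to; from)

module Comparability {A : Set} {ℓ : Level} (_≺_ : Rel A ℓ) (≺-trans : Transitive _≺_) where

  Comparable : A → A → Set ℓ
  Comparable x y = x ≺ y ⊎ y ≺ x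

  below : ∀ {x y z} → x ≺ y → Comparable z y → ¬ Comparable x z → z ≺ y
  below x≺y (inj₁ z≺y) _    = z≺y
  below x≺y (inj₂ y≺z) x≁z = ⊥-elim (x≁z (inj₁ (≺-trans x≺y y≺z)))

  above : ∀ {x y z} → x ≺ y → Comparable x z → ¬ Comparable y z → x ≺ z
  above x≺y (inj₁ x≺z) _    = x≺z
  above x≺y (inj₂ z≺x) y≁z = ⊥-elim (y≁z (inj₂ (≺-trans z≺x x≺y)))

  transfer : ∀ {w a b c d} →
    Comparable w a → Comparable w b → ¬ Comparable a b →
    Comparable c a → ¬ Comparable c w →
    Comparable d b → ¬ Comparable d w →
    c ≺ a → d ≺ b
  transfer w~a w~b a≁b c~a c≁w d~b d≁w c≺a = d≺b
    where
    w≺a = below c≺a w~a c≁w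
    w≺b = above w≺a w~b a≁b
    d≺b = below w≺b d~b (λ w~d → d≁w (swap w~d))

-- In a permutation representation, x ◁ y says that x crosses y from the
-- left (top x left of top y, bot x right of bot y).  Crossing is exactly
-- ◁-comparability, and ◁ is a strict order.
module LeftCrossing {V : Set} (R : PermRep V) where
  open PermRep R

  _◁_ : V → V → Set
  x ◁ y = top x < top y × bot y < bot x

  ◁-trans : Transitive _◁_
  ◁-trans (tx<ty , by<bx) (ty<tz , bz<by) = <-trans tx<ty ty<tz , <-trans bz<by by<bx

  _◁?_ : Decidable _◁_
  x ◁? y = (top x <? top y) ×-dec (bot y <? bot x)

  ◁⇒Φ : ∀ {x y} → y ◁ x → Φ R x y
  ◁⇒Φ y◁x@(ty<tx , bx<by) = inj₂ y◁x , +-mono-< ty<tx bx<by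

module SortedBlocks {N n : ℕ} (var : Fin N → Fin n)
  (sorted : ∀ p q → var p F.< var q → p F.< q) where

  sameVarBetween : ∀ {p q r} → var p ≡ var q → p F.≤ r → r F.≤ q → var r ≡ var p
  sameVarBetween {p} {q} {r} same p≤r r≤q with FP.<-cmp (var r) (var p)
  ... | tri< r<p _ _ = ⊥-elim (<⇒≱ (sorted r p r<p) p≤r)
  ... | tri≈ _ eq _  = eq
  ... | tri> _ _ p<r = ⊥-elim (<⇒≱ (sorted q r (subst (F._< var r) same p<r)) r≤q)

  module _ {P : Fin N → Set}
    (step : ∀ {p q} → toℕ q ≡ suc (toℕ p) → var p ≡ var q → P p ⇔ P q) where

    walk : ∀ m p q → toℕ q ≡ m + toℕ p → var p ≡ var q → P p ⇔ P q
    walk zero p q q≡p _ = subst (λ z → P p ⇔ P z) (FP.toℕ-injective (sym q≡p)) (⇔-id (P p))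
    walk (suc m) p q q≡m+p same = walk m p⁺ q q≡m+p⁺ (trans (sym p~p⁺) same) ⇔-∘ step p⁺≡1+p p~p⁺
      where
      1+p≤q : suc (toℕ p) ≤ toℕ q
      1+p≤q = subst (suc (toℕ p) ≤_) (sym q≡m+p) (s≤s (m≤n+m (toℕ p) m))
      p⁺ : Fin N
      p⁺ = fromℕ< (≤-<-trans 1+p≤q (FP.toℕ<n q))
      p⁺≡1+p : toℕ p⁺ ≡ suc (toℕ p)
      p⁺≡1+p = FP.toℕ-fromℕ< _
      p~p⁺ : var p ≡ var p⁺
      p~p⁺ = sym (sameVarBetween same
        (subst (toℕ p ≤_) (sym p⁺≡1+p) (n≤1+n (toℕ p)))
        (subst (_≤ toℕ q) (sym p⁺≡1+p) 1+p≤q))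
      q≡m+p⁺ : toℕ q ≡ m + toℕ p⁺
      q≡m+p⁺ = trans q≡m+p (trans (sym (+-suc m (toℕ p))) (cong (m +_) (sym p⁺≡1+p)))

    blockInvariant : ∀ p q → var p ≡ var q → P p → P q
    blockInvariant p q same with ≤-total (toℕ p) (toℕ q)
    ... | inj₁ p≤q = to (walk (toℕ q ∸ toℕ p) p q (sym (m∸n+n≡m p≤q)) same)
    ... | inj₂ q≤p = from (walk (toℕ p ∸ toℕ q) q p (sym (m∸n+n≡m q≤p)) (sym same))

module InducedAssignment {N n : ℕ} (var : Fin N → Fin n)
  {P : Fin N → Set} (P? : ∀ p → Dec (P p))
  (invariant : ∀ p q → var p ≡ var q → P p → P q) where

  β : Fin n → Bool
  β x = isYes (FP.any? (λ p → (var p FP.≟ x) ×-dec P? p))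

  β-spec : ∀ p → β (var p) ≡ true ⇔ P p
  β-spec p with FP.any? (λ q → (var q FP.≟ var p) ×-dec P? q)
  ... | yes (q , q~p , Pq) = mk⇔ (λ _ → invariant q p q~p Pq) (λ _ → refl)
  ... | no none             = mk⇔ (λ ()) (λ Pp → ⊥-elim (none (p , refl , Pp)))

bothValues : ∀ {m} (b : Fin m → Bool) →
  ¬ (∀ j → b j ≡ true) → ¬ (∀ j → b j ≡ false) →
  (∃ λ j → b j ≡ true) × (∃ λ j → b j ≡ false)
bothValues {m} b notAllTrue notAllFalse =
  (proj₁ someTrue , ¬-not (proj₂ someTrue)) , (proj₁ someFalse , ¬-not (proj₂ someFalse))
  where
  someTrue  = FP.¬∀⟶∃¬ m _ (λ j → b j BP.≟ false) notAllFalse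
  someFalse = FP.¬∀⟶∃¬ m _ (λ j → b j BP.≟ true) notAllTrue

module AcyclicRepresentation {n k : ℕ} (φ : Formula n k) (L : Layout φ)
  (R : PermRep (PV φ L)) (rep : Represents R (PAdj φ L))
  (acyclic : Acyclic (FArc R (pairOf φ L))) where
  open Layout L
  open LeftCrossing R
  open Comparability _◁_ ◁-trans

  adjacent : ∀ {x y} → PArc φ L x y → Comparable x y
  adjacent {x} {y} a = proj₁ (rep x y) (inj₁ a)

  adjacent⁻ : ∀ {x y} → PArc φ L y x → Comparable x y
  adjacent⁻ {x} {y} a = proj₁ (rep x y) (inj₂ a)

  ℓ¹≁ℓ¹ : ∀ o o' → ¬ Comparable (ℓ¹ o) (ℓ¹ o')
  ℓ¹≁ℓ¹ o o' c with proj₂ (rep (ℓ¹ o) (ℓ¹ o')) c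
  ... | inj₁ ()
  ... | inj₂ ()

  ℓ²≁u : ∀ o λ' → ¬ Comparable (ℓ² o) (u λ')
  ℓ²≁u o λ' c with proj₂ (rep (ℓ² o) (u λ')) c
  ... | inj₁ ()
  ... | inj₂ ()

  Reversed : Occ k → Set
  Reversed o = ℓ² o ◁ ℓ¹ o

  -- The line u of a link crosses both ℓ¹'s and neither ℓ², so it forces
  -- the two occurrences it joins to be reversed together.
  linkReversed : (λ' : Link φ L) → Reversed (leftOcc φ L λ') ⇔ Reversed (rightOcc φ L λ')
  linkReversed λ' = mk⇔ (transfer uˡ uʳ (ℓ¹≁ℓ¹ _ _) ℓℓˡ (ℓ²≁u _ λ') ℓℓʳ (ℓ²≁u _ λ'))
                        (transfer uʳ uˡ (ℓ¹≁ℓ¹ _ _) ℓℓʳ (ℓ²≁u _ λ') ℓℓˡ (ℓ²≁u _ λ'))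
    where
    uˡ = adjacent (uL λ')
    uʳ = adjacent (uR λ')
    ℓℓˡ = adjacent⁻ (ℓℓ (leftOcc φ L λ'))
    ℓℓʳ = adjacent⁻ (ℓℓ (rightOcc φ L λ'))

  position : Fin (3 * k) → Fin n
  position p = occVar φ (σ p)

  reversedInvariant : ∀ p q → position p ≡ position q → Reversed (σ p) → Reversed (σ q)
  reversedInvariant = SortedBlocks.blockInvariant position sorted
    (λ {p} {q} q≡1+p same → linkReversed (p , q , q≡1+p , same))

  open InducedAssignment position (λ p → ℓ² (σ p) ◁? ℓ¹ (σ p)) reversedInvariant
    using (β; β-spec) public

  β-reversed : ∀ o → β (occVar φ o) ≡ true ⇔ Reversed o
  β-reversed o with proj₂ σ-bij o
  ... | p , hits = subst (λ o → β (occVar φ o) ≡ true ⇔ Reversed o) (hits refl) (β-spec p)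

  splitPair : ∀ o → pairOf φ L (ℓ¹ o) ≢ pairOf φ L (ℓ² o)
  splitPair (i , F.zero)                = λ ()
  splitPair (i , F.suc F.zero)          = λ ()
  splitPair (i , F.suc (F.suc F.zero))  = λ ()

  reversedArc : ∀ o → Reversed o → FArc R (pairOf φ L) (pairOf φ L (ℓ¹ o)) (pairOf φ L (ℓ² o))
  reversedArc o r = splitPair o , ℓ¹ o , ℓ² o , refl , refl , ◁⇒Φ r

  straightArc : ∀ o → ¬ Reversed o → FArc R (pairOf φ L) (pairOf φ L (ℓ² o)) (pairOf φ L (ℓ¹ o))
  straightArc o ¬r = ≢-sym (splitPair o) , ℓ² o , ℓ¹ o , refl , refl , ◁⇒Φ (ℓ¹◁ℓ² (adjacent⁻ (ℓℓ o)))
    where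
    ℓ¹◁ℓ² : Comparable (ℓ² o) (ℓ¹ o) → ℓ¹ o ◁ ℓ² o
    ℓ¹◁ℓ² (inj₁ r)   = ⊥-elim (¬r r)
    ℓ¹◁ℓ² (inj₂ l◁r) = l◁r

  -- Equal orientations on a clause close the cycle ab → cd → ef → ab
  -- (or its reverse) in F_R.
  notAllReversed : ∀ i → ¬ (∀ j → Reversed (i , j))
  notAllReversed i rev = acyclic (ab i)
    (reversedArc (i , F.zero) (rev _) ∷ reversedArc (i , F.suc (F.suc F.zero)) (rev _)
      ∷ [ reversedArc (i , F.suc F.zero) (rev _) ])

  notAllStraight : ∀ i → ¬ (∀ j → ¬ Reversed (i , j))
  notAllStraight i str = acyclic (ab i)
    (straightArc (i , F.suc F.zero) (str _) ∷ straightArc (i , F.suc (F.suc F.zero)) (str _)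
      ∷ [ straightArc (i , F.zero) (str _) ])

  naeClause : ∀ i → (∃ λ j → β (varOf (φ i) j) ≡ true) × (∃ λ j → β (varOf (φ i) j) ≡ false)
  naeClause i = bothValues (λ j → β (varOf (φ i) j))
    (λ allTrue → notAllReversed i (λ j → to (β-reversed (i , j)) (allTrue j)))
    (λ allFalse → notAllStraight i (λ j r → falseNotTrue (trans (sym (allFalse j)) (from (β-reversed (i , j)) r))))
    where
    falseNotTrue : false ≢ true
    falseNotTrue ()

lemma3p1 : ∀ {n k} (φ : Formula n k) (L : Layout φ) →
    AcyclicWrt (PAdj φ L) (pairOf φ L) → NAESat φ
lemma3p1 φ L (R , represents , acyclic) = β , naeClause
  where open AcyclicRepresentation φ L R represents acyclic
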